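{- Let $X$ be an augmented semi-simplicial set all of whose sets of simplices $X_m$ are finite. Then (i) $|\mathrm{Cil}(X)| = |X\,\widetilde{\vartriangleright}\,\mathrm{Cil}| = |X|\,\widetilde{\triangleright}\,|\mathrm{Cil}|$; (ii) $|\mathrm{Cil}_0(X)| = |X\,\widetilde{\vartriangleright}\,\mathrm{Cil}_0| = |X|\,\widetilde{\triangleright}\,|\mathrm{Cil}_0|$; (iii) $|\mathrm{Cil}_2(X)| = |X\,\widetilde{\vartriangleright}\,\mathrm{Cil}_2| = |X|\,\widetilde{\triangleright}\,|\mathrm{Cil}_2|$. Consequently $|\cdot|\circ\mathrm{Cil}=\mathrm{cil}\circ|\cdot|$, $|\cdot|\circ\mathrm{Cil}_0=\mathrm{cil}_0\circ|\cdot|$ and $|\cdot|\circ\mathrm{Cil}_2=\mathrm{cil}_2\circ|\cdot|$ on such $X$.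
   Context: $\mathbf{\Gamma}_+$: objects $[n]=\{0<\dots<n\}$ ($n\ge0$) and $[-1]=\emptyset$, morphisms strictly increasing maps. An augmented semi-simplicial set is a functor $X:\mathbf{\Gamma}_+^{op}\to\mathbf{Sets}$, $X_m=X([m])$, $m\ge-1$; $|X|=(|X_m|)_{m\ge -1}$. $\Gamma_+[n]=\mathrm{Hom}_{\mathbf{\Gamma}_+}(-,[n])$, whose $p$-simplices are strictly increasing maps $[p]\to[n]$ ($\Gamma_+[n]_{ -1}=\{\emptyset\}$). For $Z:\mathbf{\Gamma}_+\to\mathbf{Sets}^{\mathbf{\Gamma}_+^{op}}$, $X\,\widetilde{\vartriangleright}\,Z$ is the colimit of $Z\circ\pi_X$ over the category of elements of $X$ (the colimit-preserving extension of $Z$ along $[n]\mapsto\Gamma_+[n]$); $|Z|$ is the matrix $(|Z([n])_m|)_{n,m\ge-1}$. Cylinders: for $\sigma\in\Gamma_+[n]_p$, $\tau\in\Gamma_+[n]_q$ write $\sigma\preccurlyeq\tau$ if $|\sigma([p])\cap\tau([q])|\le1$ and $\sigma(i)\le\tau(j)$ for all $i,j$; write $\sigma\prec\tau$ if the images are disjoint and $\sigma(i)<\tau(j)$ for all $i,j$ (both hold automatically if $p=-1$ or $q=-1$). $\mathrm{Cil}_2\Gamma_+[n]_m$ is the set of pairs $(\sigma,\tau)\in\Gamma_+[n]_p\times\Gamma_+[n]_q$ with $p,q\ge-1$, $p+q=m-1$, with faces $d_i(\sigma,\tau)=(d_i\sigma,\tau)$ for $0\le i\le p$ and $(\sigma,d_{i-p-1}\tau)$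 for $p+1\le i\le m$ (this is the join $\Gamma_+[n]\boxplus\Gamma_+[n]$). $\mathrm{Cil}\Gamma_+[n]$ and $\mathrm{Cil}_0\Gamma_+[n]$ are the sub-objects of pairs with $\sigma\preccurlyeq\tau$, resp. $\sigma\prec\tau$. A morphism $\varphi$ of $\mathbf{\Gamma}_+$ acts by $(\sigma,\tau)\mapsto(\varphi\sigma,\varphi\tau)$, giving functors $\mathrm{Cil},\mathrm{Cil}_0,\mathrm{Cil}_2:\mathbf{\Gamma}_+\to\mathbf{Sets}^{\mathbf{\Gamma}_+^{op}}$; $\mathrm{Cil}(X):=X\,\widetilde{\vartriangleright}\,\mathrm{Cil}$, etc. Algebra: sequences/matrices indexed by $\mathbb{N}_+=\{ -1,0,1,\dots\}$; $\mathrm{bin}_{i,j}=\binom{i+1}{j+1}$, $\mathrm{bin}^{ -1}_{i,j}=(-1)^{i-j}\binom{i+1}{j+1}$. For a matrix $B$ such that every column of $\mathrm{bin}^{ -1}\cdot B$ is eventually zero, and any sequence $a$, $a\,\widetilde{\triangleright}\,B:=a\cdot(\mathrm{bin}^{ -1}\cdot B)$ (this equals $(a\cdot\mathrm{bin}^{ -1})\cdot B$ for finitely supported $a$). $\mathrm{cil}:=|\mathrm{Cil}|$, $\mathrm{cil}_0:=|\mathrm{Cil}_0|$, $\mathrm{cil}_2:=|\mathrm{Cil}_2|$ and, as operators on sequences, $\mathrm{cil}(a):=a\,\widetilde{\triangleright}\,\mathrm{cil}$, $\mathrm{cil}_0(a):=a\,\widetilde{\triangleright}\,\mathrm{cil}_0$,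 $\mathrm{cil}_2(a):=a\,\widetilde{\triangleright}\,\mathrm{cil}_2$. -}

module Defs where

open import Level using (0ℓ)
open import Data.Nat as ℕ using (ℕ; zero; suc; _+_; _∸_)
open import Data.Nat.Combinatorics using (_C_)
open import Data.Fin as Fin using (Fin; zero; suc)
open import Data.Fin.Properties using (all?; _≟_)
open import Data.Integer as ℤ using (ℤ; +_; -_; _*_; _^_)
open import Data.Product using (Σ; _×_; _,_)
open import Data.Unit using (⊤; tt)
open import Relation.Nullary using (Dec; yes; no; ¬_)
open import Relation.Nullary.Decidable using (True; _×-dec_; _→-dec_; ¬?)
open import Relation.Binary.Bundles using (Setoid)
open import Relation.Binary.PropositionalEquality using (_≡_; _≢_)
import Relation.Binary.PropositionalEquality as ≡
open import Relation.Binary.Construct.Closure.Equivalence as EqC using (EqClosure)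
open import Function.Bundles using (Bijection; _↔_)

-- The category Γ₊.  Objects [n] (n ≥ -1) are represented by their
-- number of elements N = n + 1 ∈ ℕ.  Morphisms (strictly increasing
-- maps [p] → [n]) are represented by "thinnings" a ⊑ N (a = p+1,
-- N = n+1): the canonical inductive encoding of order-preserving
-- injections Fin a → Fin N; 'apply' gives the underlying map.

data _⊑_ : ℕ → ℕ → Set where
  done : 0 ⊑ 0
  keep : ∀ {a N} → a ⊑ N → suc a ⊑ suc N
  skip : ∀ {a N} → a ⊑ N → a ⊑ suc N

apply : ∀ {a N} → a ⊑ N → Fin a → Fin N
apply (keep φ) zero    = zero
apply (keep φ) (suc i) = suc (apply φ i)
apply (skip φ) i       = suc (apply φ i)

⊑-id : ∀ {n} → n ⊑ n
⊑-id {zero}  = done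
⊑-id {suc n} = keep ⊑-id

_∘⊑_ : ∀ {l m n} → m ⊑ n → l ⊑ m → l ⊑ n
done   ∘⊑ ψ      = ψ
keep φ ∘⊑ keep ψ = keep (φ ∘⊑ ψ)
keep φ ∘⊑ skip ψ = skip (φ ∘⊑ ψ)
skip φ ∘⊑ ψ      = skip (φ ∘⊑ ψ)

-- Augmented semi-simplicial sets: functors Γ₊^op → Sets.
-- Simp (m+1) = X_m  (so Simp 0 = X_{-1}).

record AugSemiSimplicialSet : Set₁ where
  field
    Simp   : ℕ → Set
    act    : ∀ {a b} → a ⊑ b → Simp b → Simp a
    act-id : ∀ {a} (x : Simp a) → act ⊑-id x ≡ x
    act-∘  : ∀ {l m n} (φ : m ⊑ n) (ψ : l ⊑ m) (x : Simp n) →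
             act (φ ∘⊑ ψ) x ≡ act ψ (act φ x)
open AugSemiSimplicialSet public

HasCard : Setoid 0ℓ 0ℓ → ℕ → Set
HasCard S c = Bijection S (≡.setoid (Fin c))

-- Cylinders.  An element of Cil₂Γ₊[n]_m (N = n+1, k = m+1) is a pair
-- (σ, τ) ∈ Γ₊[n]_p × Γ₊[n]_q with p + q = m - 1, i.e. with sizes
-- a = p+1, b = q+1 satisfying a + b = k.

record Cyl (N k : ℕ) : Set where
  constructor cyl
  field
    a b : ℕ
    sum : a + b ≡ k
    σ   : a ⊑ N
    τ   : b ⊑ N

mapCyl : ∀ {N' N k} → N' ⊑ N → Cyl N' k → Cyl N k
mapCyl φ (cyl a b e σ τ) = cyl a b e (φ ∘⊑ σ) (φ ∘⊑ τ)

-- σ ≼ τ : |im σ ∩ im τ| ≤ 1 and σ(i) ≤ τ(j) for all i, j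
Weak : ∀ {N k} → Cyl N k → Set
Weak (cyl a b _ σ τ) =
  (∀ i i' j j' → apply σ i ≡ apply τ j → apply σ i' ≡ apply τ j' →
                 apply σ i ≡ apply σ i')
  × (∀ i j → apply σ i Fin.≤ apply τ j)

Strict : ∀ {N k} → Cyl N k → Set
Strict (cyl a b _ σ τ) =
  (∀ i j → apply σ i ≢ apply τ j)
  × (∀ i j → apply σ i Fin.< apply τ j)

Weak? : ∀ {N k} (z : Cyl N k) → Dec (Weak z)
Weak? (cyl a b _ σ τ) =
  all? (λ i → all? (λ i' → all? (λ j → all? (λ j' →
    (apply σ i ≟ apply τ j) →-dec (apply σ i' ≟ apply τ j') →-dec
    (apply σ i ≟ apply σ i')))))
  ×-dec all? (λ i → all? (λ j → apply σ i Fin.≤? apply τ j))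

Strict? : ∀ {N k} (z : Cyl N k) → Dec (Strict z)
Strict? (cyl a b _ σ τ) =
  all? (λ i → all? (λ j → ¬? (apply σ i ≟ apply τ j)))
  ×-dec all? (λ i → all? (λ j → apply σ i Fin.<? apply τ j))

NoCond : ∀ {N k} → Cyl N k → Set
NoCond _ = ⊤

NoCond? : ∀ {N k} (z : Cyl N k) → Dec (NoCond z)
NoCond? _ = yes tt

-- Sub-functors of Cil₂ cut out by a decidable (and, for the three
-- cylinder functors, Γ₊-stable) condition P.  'True (P? z)' is a
-- proof-irrelevant witness of P z.

module Cylinders (P : ∀ {N k} → Cyl N k → Set)
                 (P? : ∀ {N k} (z : Cyl N k) → Dec (P z)) where

  -- Z([n])_m   (N = n+1, k = m+1)
  ZSimp : ℕ → ℕ → Set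
  ZSimp N k = Σ (Cyl N k) (λ z → True (P? z))

  -- the m-simplices of X ▷̃ Z  (k = m+1), computed levelwise as the
  -- colimit over the category of elements of X of Z(-)_m:
  -- elements (x ∈ X_n, z ∈ Z([n])_m), modulo the equivalence relation
  -- generated by (X(φ)x, z) ~ (x, Z(φ)z).
  module _ (X : AugSemiSimplicialSet) (k : ℕ) where

    record Elt : Set where
      constructor elt
      field
        N  : ℕ
        x  : Simp X N
        z  : Cyl N k
        ok : True (P? z)

    data Gen : Elt → Elt → Set where
      gen : ∀ {N' N} (φ : N' ⊑ N) (x : Simp X N) (z : Cyl N' k)
              (p : True (P? z)) (q : True (P? (mapCyl φ z))) →
            Gen (elt N' (act X φ x) z p) (elt N x (mapCyl φ z) q)

    ColimSetoid : Setoid 0ℓ 0ℓ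
    ColimSetoid = EqC.setoid Gen

-- Algebra.  Sequences/matrices indexed by ℕ₊ = {-1,0,1,...} are
-- represented with index shift i ↦ i+1, so indices range over ℕ.

-- bin⁻¹_{i,j} = (-1)^{i-j} binom(i+1, j+1)   (shifted: I = i+1, J = j+1;
-- the entry is 0 for J > I since binom I J = 0 then)
binInv : ℕ → ℕ → ℤ
binInv I J = ((- + 1) ^ (I ∸ J)) * + (I C J)

sumTo : ℕ → (ℕ → ℤ) → ℤ
sumTo zero    f = + 0
sumTo (suc n) f = sumTo n f ℤ.+ f n

-- (bin⁻¹ · B)_{I,K}  (finite sum: bin⁻¹ is lower triangular)
binInvMul : (ℕ → ℕ → ℤ) → ℕ → ℕ → ℤ
binInvMul B I K = sumTo (suc I) (λ J → binInv I J * B J K)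

-- "(a ▷̃ B)_K is defined and equals v": column K of bin⁻¹ · B is
-- eventually zero (from L on), and v = Σ_I a_I (bin⁻¹ · B)_{I,K}.
TriValue : (ℕ → ℤ) → (ℕ → ℕ → ℤ) → ℕ → ℤ → Set
TriValue a B K v =
  Σ ℕ (λ L → (∀ I → L ℕ.≤ I → binInvMul B I K ≡ + 0)
             × (v ≡ sumTo L (λ I → a I * binInvMul B I K)))

CountFormula : (P : ∀ {N k} → Cyl N k → Set)
               (P? : ∀ {N k} (z : Cyl N k) → Dec (P z)) → Set₁
CountFormula P P? =
  (X : AugSemiSimplicialSet) (sz : ℕ → ℕ) →
  (∀ k → Simp X k ↔ Fin (sz k)) →
  (B : ℕ → ℕ → ℕ) →
  (∀ N k → Cylinders.ZSimp P P? N k ↔ Fin (B N k)) →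
  ∀ k → Σ ℕ (λ c → HasCard (Cylinders.ColimSetoid P P? X k) c
                   × TriValue (λ I → + sz I) (λ I K → + B I K) k (+ c))

{-# OPTIONS --safe #-}

-- Every cylinder (σ, τ) over [n] factors uniquely as ρ ∘ (σ′, τ′), with ρ : [r] → [n] injective
-- and the images of σ′ and τ′ jointly covering [r]; the conditions ≼ and ≺ are preserved and
-- reflected by ρ. Hence each simplex (x, z) of X ▷̃ Z is equivalent to exactly one normal form
-- (X(ρ)x, (σ′, τ′)) with (σ′, τ′) spanning, so |(X ▷̃ Z)_m| = Σ_r |X_r| s_r, where s_r counts the
-- spanning cylinders in Z([r])_m and vanishes for r > m. For the representable X = Γ₊[n] the same
-- decomposition reads |Z| = bin · s, so bin⁻¹ · |Z| has columns s and the formula follows.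

module Submission where

open import Defs
open import Level using (0ℓ)
open import Data.Bool.Properties using (T-irrelevant)
open import Data.Empty using (⊥-elim)
open import Data.Fin as Fin using (Fin; zero; suc)
import Data.Fin.Permutation as Permutation
import Data.Fin.Properties as Fin
open import Data.Integer as ℤ using (ℤ; +_; -_; _+_; _-_; _*_; _^_)
import Data.Integer.Properties as ℤ
open import Data.Integer.Tactic.RingSolver using (solve-∀)
open import Data.Nat as ℕ using (ℕ; zero; suc)
open import Data.Nat.Combinatorics using (_C_; nCk+nC[k+1]≡[n+1]C[k+1]; k>n⇒nCk≡0)
import Data.Nat.Properties as ℕ
open import Data.Product as Product using (Σ; _×_; _,_; -,_; proj₁; proj₂)
open import Data.Product.Function.Dependent.Propositional using (Σ-↔)
open import Data.Product.Function.NonDependent.Propositional using (_×-↔_)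
open import Data.Sum using (_⊎_; inj₁; inj₂)
open import Data.Sum.Function.Propositional using (_⊎-↔_)
open import Function using (_∘_)
open import Function.Bundles using (_↔_; mk↔ₛ′; Inverse; _⇔_; mk⇔; Equivalence)
open import Function.Properties.Inverse using (↔-sym; ↔-trans; ↔-refl)
open import Relation.Binary.Bundles using (Setoid)
import Relation.Binary.Reasoning.Setoid as SetoidReasoning
open import Relation.Binary.Construct.Closure.Equivalence as EqClosure using (EqClosure)
open import Relation.Binary.PropositionalEquality
open import Relation.Nullary using (Dec; yes; no; ¬_)
open import Relation.Nullary.Decidable as Dec using (True; toWitness; fromWitness)
open import Relation.Nullary.Irrelevant using (Irrelevant)
import Relation.Unary as U

private variable
  a b l m n N R k : ℕ
  A : Set

-- Thinnings

∘⊑-assoc : (φ : m ⊑ n) (ψ : l ⊑ m) (χ : a ⊑ l) → φ ∘⊑ (ψ ∘⊑ χ) ≡ (φ ∘⊑ ψ) ∘⊑ χ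
∘⊑-assoc done     ψ        χ        = refl
∘⊑-assoc (keep φ) (keep ψ) (keep χ) = cong keep (∘⊑-assoc φ ψ χ)
∘⊑-assoc (keep φ) (keep ψ) (skip χ) = cong skip (∘⊑-assoc φ ψ χ)
∘⊑-assoc (keep φ) (skip ψ) χ        = cong skip (∘⊑-assoc φ ψ χ)
∘⊑-assoc (skip φ) ψ        χ        = cong skip (∘⊑-assoc φ ψ χ)

∘⊑-identityˡ : (σ : a ⊑ n) → ⊑-id ∘⊑ σ ≡ σ
∘⊑-identityˡ done     = refl
∘⊑-identityˡ (keep σ) = cong keep (∘⊑-identityˡ σ)
∘⊑-identityˡ (skip σ) = cong skip (∘⊑-identityˡ σ)

apply-∘ : (φ : m ⊑ n) (ψ : l ⊑ m) (i : Fin l) → apply (φ ∘⊑ ψ) i ≡ apply φ (apply ψ i)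
apply-∘ (keep φ) (keep ψ) zero    = refl
apply-∘ (keep φ) (keep ψ) (suc i) = cong suc (apply-∘ φ ψ i)
apply-∘ (keep φ) (skip ψ) i       = cong suc (apply-∘ φ ψ i)
apply-∘ (skip φ) ψ        i       = cong suc (apply-∘ φ ψ i)

⊑⇒≤ : a ⊑ n → a ℕ.≤ n
⊑⇒≤ done     = ℕ.z≤n
⊑⇒≤ (keep σ) = ℕ.s≤s (⊑⇒≤ σ)
⊑⇒≤ (skip σ) = ℕ.m≤n⇒m≤1+n (⊑⇒≤ σ)

apply-injective : (φ : m ⊑ n) {i j : Fin m} → apply φ i ≡ apply φ j → i ≡ j
apply-injective (keep φ) {zero}  {zero}  _ = refl
apply-injective (keep φ) {suc i} {suc j} p = cong suc (apply-injective φ (Fin.suc-injective p))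
apply-injective (skip φ)                 p = apply-injective φ (Fin.suc-injective p)

apply-mono-≤ : (φ : m ⊑ n) {i j : Fin m} → i Fin.≤ j → apply φ i Fin.≤ apply φ j
apply-mono-≤ (keep φ) {zero}          _           = ℕ.z≤n
apply-mono-≤ (keep φ) {suc i} {suc j} (ℕ.s≤s i≤j) = ℕ.s≤s (apply-mono-≤ φ i≤j)
apply-mono-≤ (skip φ)                 i≤j         = ℕ.s≤s (apply-mono-≤ φ i≤j)

apply-cancel-≤ : (φ : m ⊑ n) {i j : Fin m} → apply φ i Fin.≤ apply φ j → i Fin.≤ j
apply-cancel-≤ (keep φ) {zero}          _             = ℕ.z≤n
apply-cancel-≤ (keep φ) {suc i} {suc j} (ℕ.s≤s φi≤φj) = ℕ.s≤s (apply-cancel-≤ φ φi≤φj)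
apply-cancel-≤ (skip φ)                 (ℕ.s≤s φi≤φj) = apply-cancel-≤ φ φi≤φj

apply-mono-< : (φ : m ⊑ n) {i j : Fin m} → i Fin.< j → apply φ i Fin.< apply φ j
apply-mono-< (keep φ) {zero}  {suc j} _           = ℕ.s≤s ℕ.z≤n
apply-mono-< (keep φ) {suc i} {suc j} (ℕ.s≤s i<j) = ℕ.s≤s (apply-mono-< φ i<j)
apply-mono-< (skip φ)                 i<j         = ℕ.s≤s (apply-mono-< φ i<j)

apply-cancel-< : (φ : m ⊑ n) {i j : Fin m} → apply φ i Fin.< apply φ j → i Fin.< j
apply-cancel-< (keep φ) {zero}  {suc j} _             = ℕ.s≤s ℕ.z≤n
apply-cancel-< (keep φ) {suc i} {suc j} (ℕ.s≤s φi<φj) = ℕ.s≤s (apply-cancel-< φ φi<φj)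
apply-cancel-< (skip φ)                 (ℕ.s≤s φi<φj) = apply-cancel-< φ φi<φj

module _ (φ : m ⊑ n) {_∼_ : ∀ {p} → Fin p → Fin p → Set}
         (apply-∼ : ∀ {i j : Fin m} → apply φ i ∼ apply φ j ⇔ i ∼ j) where

  ∘⊑-∼ : (σ : a ⊑ m) (τ : b ⊑ m) (i : Fin a) (j : Fin b) →
         apply (φ ∘⊑ σ) i ∼ apply (φ ∘⊑ τ) j ⇔ apply σ i ∼ apply τ j
  ∘⊑-∼ σ τ i j = subst₂ (λ x y → x ∼ y ⇔ _) (sym (apply-∘ φ σ i)) (sym (apply-∘ φ τ j)) apply-∼

-- Invariance of the cylinder conditions

mapCyl-∘ : (φ : m ⊑ n) (ψ : l ⊑ m) (z : Cyl l k) → mapCyl φ (mapCyl ψ z) ≡ mapCyl (φ ∘⊑ ψ) z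
mapCyl-∘ φ ψ (cyl a b e σ τ) = cong₂ (cyl a b e) (∘⊑-assoc φ ψ σ) (∘⊑-assoc φ ψ τ)

mapCyl-id : (z : Cyl n k) → mapCyl ⊑-id z ≡ z
mapCyl-id (cyl a b e σ τ) = cong₂ (cyl a b e) (∘⊑-identityˡ σ) (∘⊑-identityˡ τ)

Invariant : (∀ {N k} → Cyl N k → Set) → Set
Invariant P = ∀ {N′ N k} (φ : N′ ⊑ N) (z : Cyl N′ k) → P (mapCyl φ z) ⇔ P z

module _ (φ : m ⊑ n) (σ : a ⊑ m) (τ : b ⊑ m) (i : Fin a) (j : Fin b) where

  ∘⊑-≡⇔ : apply (φ ∘⊑ σ) i ≡ apply (φ ∘⊑ τ) j ⇔ apply σ i ≡ apply τ j
  ∘⊑-≡⇔ = ∘⊑-∼ φ {_≡_} (mk⇔ (apply-injective φ) (cong (apply φ))) σ τ i j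

  ∘⊑-≤⇔ : apply (φ ∘⊑ σ) i Fin.≤ apply (φ ∘⊑ τ) j ⇔ apply σ i Fin.≤ apply τ j
  ∘⊑-≤⇔ = ∘⊑-∼ φ {Fin._≤_} (mk⇔ (apply-cancel-≤ φ) (apply-mono-≤ φ)) σ τ i j

  ∘⊑-<⇔ : apply (φ ∘⊑ σ) i Fin.< apply (φ ∘⊑ τ) j ⇔ apply σ i Fin.< apply τ j
  ∘⊑-<⇔ = ∘⊑-∼ φ {Fin._<_} (mk⇔ (apply-cancel-< φ) (apply-mono-< φ)) σ τ i j

weak-invariant : Invariant Weak
weak-invariant φ (cyl a b e σ τ) = mk⇔
  (λ (meet , order) →
     (λ i i′ j j′ p q → to (∘⊑-≡⇔ φ σ σ i i′)
                           (meet i i′ j j′ (from (∘⊑-≡⇔ φ σ τ i j) p) (from (∘⊑-≡⇔ φ σ τ i′ j′) q)))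
     , λ i j → to (∘⊑-≤⇔ φ σ τ i j) (order i j))
  (λ (meet , order) →
     (λ i i′ j j′ p q → from (∘⊑-≡⇔ φ σ σ i i′)
                             (meet i i′ j j′ (to (∘⊑-≡⇔ φ σ τ i j) p) (to (∘⊑-≡⇔ φ σ τ i′ j′) q)))
     , λ i j → from (∘⊑-≤⇔ φ σ τ i j) (order i j))
  where open Equivalence

strict-invariant : Invariant Strict
strict-invariant φ (cyl a b e σ τ) = mk⇔
  (λ (disjoint , order) → (λ i j p → disjoint i j (from (∘⊑-≡⇔ φ σ τ i j) p))
                          , λ i j → to (∘⊑-<⇔ φ σ τ i j) (order i j))
  (λ (disjoint , order) → (λ i j p → disjoint i j (to (∘⊑-≡⇔ φ σ τ i j) p))
                          , λ i j → from (∘⊑-<⇔ φ σ τ i j) (order i j))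
  where open Equivalence

noCond-invariant : Invariant NoCond
noCond-invariant _ _ = mk⇔ _ _

-- Image factorisation of cylinders

data Covering : a ⊑ R → b ⊑ R → Set where
  []    : Covering done done
  both  : {σ : a ⊑ R} {τ : b ⊑ R} → Covering σ τ → Covering (keep σ) (keep τ)
  left  : {σ : a ⊑ R} {τ : b ⊑ R} → Covering σ τ → Covering (keep σ) (skip τ)
  right : {σ : a ⊑ R} {τ : b ⊑ R} → Covering σ τ → Covering (skip σ) (keep τ)

Covering-irrelevant : {σ : a ⊑ R} {τ : b ⊑ R} → Irrelevant (Covering σ τ)
Covering-irrelevant []        []         = refl
Covering-irrelevant (both c)  (both c′)  = cong both (Covering-irrelevant c c′)
Covering-irrelevant (left c)  (left c′)  = cong left (Covering-irrelevant c c′)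
Covering-irrelevant (right c) (right c′) = cong right (Covering-irrelevant c c′)

covering? : (σ : a ⊑ R) (τ : b ⊑ R) → Dec (Covering σ τ)
covering? done     done     = yes []
covering? (keep σ) (keep τ) = Dec.map′ both  (λ { (both c) → c })  (covering? σ τ)
covering? (keep σ) (skip τ) = Dec.map′ left  (λ { (left c) → c })  (covering? σ τ)
covering? (skip σ) (keep τ) = Dec.map′ right (λ { (right c) → c }) (covering? σ τ)
covering? (skip σ) (skip τ) = no λ ()

covering⇒≤ : {σ : a ⊑ R} {τ : b ⊑ R} → Covering σ τ → R ℕ.≤ a ℕ.+ b
covering⇒≤                         []        = ℕ.z≤n
covering⇒≤ {a = suc a} {b = suc b} (both c)  =
  ℕ.s≤s (ℕ.≤-trans (covering⇒≤ c) (ℕ.+-monoʳ-≤ a (ℕ.n≤1+n b)))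
covering⇒≤                         (left c)  = ℕ.s≤s (covering⇒≤ c)
covering⇒≤ {a = a} {b = suc b}     (right c) =
  ℕ.≤-trans (ℕ.s≤s (covering⇒≤ c)) (ℕ.≤-reflexive (sym (ℕ.+-suc a b)))

record Factorisation (a b N : ℕ) : Set where
  constructor factorisation
  field
    {rank}   : ℕ
    image    : rank ⊑ N
    σ′       : a ⊑ rank
    τ′       : b ⊑ rank
    covering : Covering σ′ τ′

factorise : a ⊑ N → b ⊑ N → Factorisation a b N
factorise done     done     = factorisation done done done []
factorise (keep σ) (keep τ) = let factorisation ρ s t c = factorise σ τ in
                              factorisation (keep ρ) (keep s) (keep t) (both c)
factorise (keep σ) (skip τ) = let factorisation ρ s t c = factorise σ τ in
                              factorisation (keep ρ) (keep s) (skip t) (left c)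
factorise (skip σ) (keep τ) = let factorisation ρ s t c = factorise σ τ in
                              factorisation (keep ρ) (skip s) (keep t) (right c)
factorise (skip σ) (skip τ) = let factorisation ρ s t c = factorise σ τ in
                              factorisation (skip ρ) s t c

factorise-correct : (σ : a ⊑ N) (τ : b ⊑ N) →
                    let open Factorisation (factorise σ τ) in image ∘⊑ σ′ ≡ σ × image ∘⊑ τ′ ≡ τ
factorise-correct done     done     = refl , refl
factorise-correct (keep σ) (keep τ) = Product.map (cong keep) (cong keep) (factorise-correct σ τ)
factorise-correct (keep σ) (skip τ) = Product.map (cong keep) (cong skip) (factorise-correct σ τ)
factorise-correct (skip σ) (keep τ) = Product.map (cong skip) (cong keep) (factorise-correct σ τ)
factorise-correct (skip σ) (skip τ) = Product.map (cong skip) (cong skip) (factorise-correct σ τ)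

factorise-unique : (ρ : R ⊑ N) {s : a ⊑ R} {t : b ⊑ R} (c : Covering s t) →
                   factorise (ρ ∘⊑ s) (ρ ∘⊑ t) ≡ factorisation ρ s t c
factorise-unique done     []        = refl
factorise-unique (keep ρ) (both c)  rewrite factorise-unique ρ c = refl
factorise-unique (keep ρ) (left c)  rewrite factorise-unique ρ c = refl
factorise-unique (keep ρ) (right c) rewrite factorise-unique ρ c = refl
factorise-unique (skip ρ) c         rewrite factorise-unique ρ c = refl

Spanning : Cyl R k → Set
Spanning (cyl _ _ _ σ τ) = Covering σ τ

spanning? : (z : Cyl R k) → Dec (Spanning z)
spanning? (cyl _ _ _ σ τ) = covering? σ τ

Spanning-irrelevant : (z : Cyl R k) → Irrelevant (Spanning z)
Spanning-irrelevant (cyl _ _ _ σ τ) = Covering-irrelevant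

Factored : ℕ → ℕ → Set
Factored N k = Σ ℕ λ R → R ⊑ N × Σ (Cyl R k) Spanning

factor : Cyl N k → Factored N k
factor (cyl a b e σ τ) = let factorisation ρ s t c = factorise σ τ in -, ρ , cyl a b e s t , c

unfactor : Factored N k → Cyl N k
unfactor (_ , ρ , z , _) = mapCyl ρ z

unfactor-factor : (z : Cyl N k) → unfactor (factor z) ≡ z
unfactor-factor (cyl a b e σ τ) =
  let σ-eq , τ-eq = factorise-correct σ τ in cong₂ (cyl a b e) σ-eq τ-eq

factor-unfactor : (f : Factored N k) → factor (unfactor f) ≡ f
factor-unfactor (_ , ρ , cyl a b e s t , c) rewrite factorise-unique ρ c = refl

mapFactored : m ⊑ n → Factored m k → Factored n k
mapFactored φ (R , ρ , w) = R , φ ∘⊑ ρ , w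

factor-mapCyl : (φ : m ⊑ n) (z : Cyl m k) → factor (mapCyl φ z) ≡ mapFactored φ (factor z)
factor-mapCyl φ z = begin
  factor (mapCyl φ z)                           ≡⟨ cong (factor ∘ mapCyl φ) (unfactor-factor z) ⟨
  factor (mapCyl φ (unfactor (factor z)))       ≡⟨ cong factor (mapCyl-∘ φ _ _) ⟩
  factor (unfactor (mapFactored φ (factor z)))  ≡⟨ factor-unfactor (mapFactored φ (factor z)) ⟩
  mapFactored φ (factor z)                      ∎
  where open ≡-Reasoning

factor-spanning : (z : Cyl R k) (c : Spanning z) → factor z ≡ (R , ⊑-id , z , c)
factor-spanning z c = trans (cong factor (sym (mapCyl-id z))) (factor-unfactor (-, ⊑-id , z , c))

-- Finite cardinalities

↔Fin0 : ¬ A → A ↔ Fin 0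
↔Fin0 ¬x = mk↔ₛ′ (⊥-elim ∘ ¬x) (λ ()) (λ ()) (⊥-elim ∘ ¬x)

↔Fin1 : A → Irrelevant A → A ↔ Fin 1
↔Fin1 x irr = mk↔ₛ′ (λ _ → zero) (λ _ → x) (λ { zero → refl }) (irr x)

card-unique : A ↔ Fin m → A ↔ Fin n → m ≡ n
card-unique f g = Permutation.↔⇒≡ (↔-trans (↔-sym f) g)

Σ-Fin-suc↔ : {Q : Fin (suc n) → Set} → Σ (Fin (suc n)) Q ↔ (Q zero ⊎ Σ (Fin n) (Q ∘ suc))
Σ-Fin-suc↔ = mk↔ₛ′ (λ { (zero , q) → inj₁ q ; (suc i , q) → inj₂ (i , q) })
                   (λ { (inj₁ q) → zero , q ; (inj₂ (i , q)) → suc i , q })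
                   (λ { (inj₁ _) → refl ; (inj₂ _) → refl })
                   (λ { (zero , _) → refl ; (suc _ , _) → refl })

Σ-ℕ-suc↔ : {Q : ℕ → Set} → Σ ℕ Q ↔ (Q 0 ⊎ Σ ℕ (Q ∘ suc))
Σ-ℕ-suc↔ = mk↔ₛ′ (λ { (zero , q) → inj₁ q ; (suc i , q) → inj₂ (i , q) })
                 (λ { (inj₁ q) → zero , q ; (inj₂ (i , q)) → suc i , q })
                 (λ { (inj₁ _) → refl ; (inj₂ _) → refl })
                 (λ { (zero , _) → refl ; (suc _ , _) → refl })

+↔ : (Fin m ⊎ Fin n) ↔ Fin (m ℕ.+ n)
+↔ = ↔-sym Fin.+↔⊎

*↔ : (Fin m × Fin n) ↔ Fin (m ℕ.* n)
*↔ = ↔-sym Fin.*↔×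

finite-subset-Fin : ∀ n {Q : Fin n → Set} → U.Decidable Q → U.Irrelevant Q →
                    Σ ℕ λ m → Σ (Fin n) Q ↔ Fin m
finite-subset-Fin zero    Q? irr = 0 , ↔Fin0 λ ()
finite-subset-Fin (suc n) Q? irr with finite-subset-Fin n (Q? ∘ suc) irr | Q? zero
... | m , rest | yes q = suc m , ↔-trans Σ-Fin-suc↔ (↔-trans (↔Fin1 q irr ⊎-↔ rest) +↔)
... | m , rest | no ¬q = m     , ↔-trans Σ-Fin-suc↔ (↔-trans (↔Fin0 ¬q ⊎-↔ rest) +↔)

finite-subset : A ↔ Fin n → {Q : A → Set} → U.Decidable Q → U.Irrelevant Q →
                Σ ℕ λ m → Σ A Q ↔ Fin m
finite-subset {n = n} f Q? irr =
  let m , g = finite-subset-Fin n (Q? ∘ from) irr in m , ↔-trans (↔-sym (Σ-↔ (↔-sym f) ↔-refl)) g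
  where open Inverse f

natSum : ℕ → (ℕ → ℕ) → ℕ
natSum zero    g = 0
natSum (suc n) g = g 0 ℕ.+ natSum n (g ∘ suc)

Σ-ℕ↔natSum : ∀ n {F : ℕ → Set} {g : ℕ → ℕ} → (∀ r → n ℕ.≤ r → ¬ F r) → (∀ r → F r ↔ Fin (g r)) →
             Σ ℕ F ↔ Fin (natSum n g)
Σ-ℕ↔natSum zero    empty count = ↔Fin0 λ (r , x) → empty r ℕ.z≤n x
Σ-ℕ↔natSum (suc n) empty count =
  ↔-trans Σ-ℕ-suc↔ (↔-trans (count 0 ⊎-↔ Σ-ℕ↔natSum n (λ r → empty (suc r) ∘ ℕ.s≤s) (count ∘ suc)) +↔)

keep-skip↔ : (suc a ⊑ suc N) ↔ ((a ⊑ N) ⊎ (suc a ⊑ N))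
keep-skip↔ = mk↔ₛ′ (λ { (keep σ) → inj₁ σ ; (skip σ) → inj₂ σ })
                   (λ { (inj₁ σ) → keep σ ; (inj₂ σ) → skip σ })
                   (λ { (inj₁ _) → refl ; (inj₂ _) → refl })
                   (λ { (keep _) → refl ; (skip _) → refl })

thinnings↔ : ∀ r N → (r ⊑ N) ↔ Fin (N C r)
thinnings↔ zero    zero    = ↔Fin1 done λ { done done → refl }
thinnings↔ (suc r) zero    = ↔Fin0 λ ()
thinnings↔ zero    (suc N) =
  ↔-trans (mk↔ₛ′ (λ { (skip σ) → σ }) skip (λ _ → refl) (λ { (skip _) → refl })) (thinnings↔ zero N)
thinnings↔ (suc r) (suc N) =
  ↔-trans keep-skip↔ (↔-trans (thinnings↔ r N ⊎-↔ thinnings↔ (suc r) N)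
    (subst (λ c → (Fin (N C r) ⊎ Fin (N C suc r)) ↔ Fin c) (nCk+nC[k+1]≡[n+1]C[k+1] N r) +↔))

module _ (S : Setoid 0ℓ 0ℓ) {A : Set}
         (nf : Setoid.Carrier S → A) (nf-cong : ∀ {x y} → Setoid._≈_ S x y → nf x ≡ nf y)
         (embed : A → Setoid.Carrier S) (nf-embed : ∀ u → nf (embed u) ≡ u)
         (embed-nf : ∀ x → Setoid._≈_ S (embed (nf x)) x) where

  open Setoid S using (Carrier; _≈_)

  hasCard-normalForms : A ↔ Fin n → HasCard S n
  hasCard-normalForms f = record
    { to        = to ∘ nf
    ; cong      = cong to ∘ nf-cong
    ; bijective = injective , surjective
    }
    where
    open Inverse f
    injective : ∀ {x y} → to (nf x) ≡ to (nf y) → x ≈ y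
    injective {x} {y} eq = begin
      x                  ≈⟨ embed-nf x ⟨
      embed (nf x)       ≡⟨ cong embed (trans (sym (strictlyInverseʳ (nf x)))
                                             (trans (cong from eq) (strictlyInverseʳ (nf y)))) ⟩
      embed (nf y)       ≈⟨ embed-nf y ⟩
      y                  ∎
      where open SetoidReasoning S
    surjective : ∀ i → Σ Carrier λ x → ∀ {y} → y ≈ x → to (nf y) ≡ i
    surjective i =
      embed (from i) , λ y≈ → trans (cong to (trans (nf-cong y≈) (nf-embed (from i)))) (strictlyInverseˡ i)

-- Binomial inversion

sumTo-cong : ∀ n {f g : ℕ → ℤ} → (∀ i → f i ≡ g i) → sumTo n f ≡ sumTo n g
sumTo-cong zero    f≗g = refl
sumTo-cong (suc n) f≗g = cong₂ _+_ (sumTo-cong n f≗g) (f≗g n)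

sumTo-+ : ∀ n (f g : ℕ → ℤ) → sumTo n (λ i → f i + g i) ≡ sumTo n f + sumTo n g
sumTo-+ zero    f g = refl
sumTo-+ (suc n) f g =
  trans (cong (_+ (f n + g n)) (sumTo-+ n f g)) (interchange (sumTo n f) (sumTo n g) (f n) (g n))
  where
  interchange : ∀ a b c d → (a + b) + (c + d) ≡ (a + c) + (b + d)
  interchange = solve-∀

sumTo-- : ∀ n (f g : ℕ → ℤ) → sumTo n (λ i → f i - g i) ≡ sumTo n f - sumTo n g
sumTo-- zero    f g = refl
sumTo-- (suc n) f g =
  trans (cong (_+ (f n - g n)) (sumTo-- n f g)) (interchange (sumTo n f) (sumTo n g) (f n) (g n))
  where
  interchange : ∀ a b c d → (a - b) + (c - d) ≡ (a + c) - (b + d)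
  interchange = solve-∀

sumTo-suc : ∀ n (f : ℕ → ℤ) → sumTo (suc n) f ≡ f 0 + sumTo n (f ∘ suc)
sumTo-suc zero    f = ℤ.+-comm (+ 0) (f 0)
sumTo-suc (suc n) f = trans (cong (_+ f (suc n)) (sumTo-suc n f)) (ℤ.+-assoc (f 0) _ _)

sumTo-extend : ∀ n {f : ℕ → ℤ} → f n ≡ + 0 → sumTo (suc n) f ≡ sumTo n f
sumTo-extend n {f} fn≡0 = trans (cong (_+_ (sumTo n f)) fn≡0) (ℤ.+-identityʳ _)

pos-natSum : ∀ n g → + natSum n g ≡ sumTo n (+_ ∘ g)
pos-natSum zero    g = refl
pos-natSum (suc n) g = begin
  + natSum (suc n) g                  ≡⟨ ℤ.pos-+ (g 0) _ ⟩
  + g 0 + + natSum n (g ∘ suc)        ≡⟨ cong (_+_ (+ g 0)) (pos-natSum n (g ∘ suc)) ⟩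
  + g 0 + sumTo n (+_ ∘ g ∘ suc)      ≡⟨ sumTo-suc n (+_ ∘ g) ⟨
  sumTo (suc n) (+_ ∘ g)              ∎
  where open ≡-Reasoning

binomial : (ℕ → ℤ) → ℕ → ℤ
binomial f J = sumTo (suc J) (λ r → + (J C r) * f r)

inverseBinomial : (ℕ → ℤ) → ℕ → ℤ
inverseBinomial g I = sumTo (suc I) (λ J → binInv I J * g J)

nC[1+n]≡0 : ∀ n → n C suc n ≡ 0
nC[1+n]≡0 n = k>n⇒nCk≡0 (ℕ.n<1+n n)

pascal : ∀ J r (x : ℤ) → + (suc J C suc r) * x ≡ + (J C r) * x + + (J C suc r) * x
pascal J r x = begin
  + (suc J C suc r) * x              ≡⟨ cong (λ c → + c * x) (nCk+nC[k+1]≡[n+1]C[k+1] J r) ⟨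
  + (J C r ℕ.+ J C suc r) * x        ≡⟨ cong (_* x) (ℤ.pos-+ (J C r) _) ⟩
  (+ (J C r) + + (J C suc r)) * x    ≡⟨ ℤ.*-distribʳ-+ x (+ (J C r)) (+ (J C suc r)) ⟩
  + (J C r) * x + + (J C suc r) * x  ∎
  where open ≡-Reasoning

binomial-suc : ∀ f J → binomial f (suc J) ≡ binomial f J + binomial (f ∘ suc) J
binomial-suc f J = begin
  binomial f (suc J)
    ≡⟨ sumTo-suc (suc J) _ ⟩
  f₀ + sumTo (suc J) (λ r → + (suc J C suc r) * f (suc r))
    ≡⟨ cong (_+_ f₀) (sumTo-cong (suc J) (λ r → pascal J r (f (suc r)))) ⟩
  f₀ + sumTo (suc J) (λ r → + (J C r) * f (suc r) + h r)
    ≡⟨ cong (_+_ f₀) (sumTo-+ (suc J) _ h) ⟩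
  f₀ + (binomial (f ∘ suc) J + sumTo (suc J) h)
    ≡⟨ cong (λ s → f₀ + (binomial (f ∘ suc) J + s)) (sumTo-extend J hJ≡0) ⟩
  f₀ + (binomial (f ∘ suc) J + sumTo J h)
    ≡⟨ rearrange f₀ (binomial (f ∘ suc) J) (sumTo J h) ⟩
  (f₀ + sumTo J h) + binomial (f ∘ suc) J
    ≡⟨ cong (_+ binomial (f ∘ suc) J) (sumTo-suc J _) ⟨
  binomial f J + binomial (f ∘ suc) J ∎
  where
  open ≡-Reasoning
  f₀ : ℤ
  f₀ = + 1 * f 0
  h : ℕ → ℤ
  h r = + (J C suc r) * f (suc r)
  hJ≡0 : h J ≡ + 0
  hJ≡0 = trans (cong (λ c → + c * f (suc J)) (nC[1+n]≡0 J)) (ℤ.*-zeroˡ (f (suc J)))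
  rearrange : ∀ a b c → a + (b + c) ≡ (a + c) + b
  rearrange = solve-∀

binInv-suc-zero : ∀ I → binInv (suc I) 0 ≡ - binInv I 0
binInv-suc-zero I = flip ((- + 1) ^ I)
  where
  flip : ∀ x → (- + 1 * x) * + 1 ≡ - (x * + 1)
  flip = solve-∀

binInv-suc-suc : ∀ I J → binInv (suc I) (suc J) ≡ binInv I J - binInv I (suc J)
binInv-suc-suc I J = begin
  s * + (suc I C suc J)                ≡⟨ cong (λ c → s * + c) (nCk+nC[k+1]≡[n+1]C[k+1] I J) ⟨
  s * + (I C J ℕ.+ I C suc J)          ≡⟨ cong (s *_) (ℤ.pos-+ (I C J) _) ⟩
  s * (+ (I C J) + + (I C suc J))      ≡⟨ ℤ.*-distribˡ-+ s _ _ ⟩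
  binInv I J + s * + (I C suc J)       ≡⟨ cong (_+_ (binInv I J)) sign-flip ⟩
  binInv I J - binInv I (suc J)        ∎
  where
  open ≡-Reasoning
  s : ℤ
  s = (- + 1) ^ (I ℕ.∸ J)
  sign-flip : s * + (I C suc J) ≡ - binInv I (suc J)
  sign-flip with J ℕ.<? I
  ... | yes J<I = begin
    s * + (I C suc J)
      ≡⟨ cong (λ e → (- + 1) ^ e * + (I C suc J)) (ℕ.+-∸-assoc 1 J<I) ⟩
    (- + 1 * (- + 1) ^ (I ℕ.∸ suc J)) * + (I C suc J)
      ≡⟨ flip ((- + 1) ^ (I ℕ.∸ suc J)) (+ (I C suc J)) ⟩
    - binInv I (suc J) ∎
    where
    flip : ∀ x c → (- + 1 * x) * c ≡ - (x * c)
    flip = solve-∀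
  ... | no J≮I rewrite k>n⇒nCk≡0 (ℕ.≰⇒> J≮I) =
    trans (ℤ.*-zeroʳ s) (sym (cong -_ (ℤ.*-zeroʳ ((- + 1) ^ (I ℕ.∸ suc J)))))

inverseBinomial-cong : ∀ {g h} I → (∀ J → g J ≡ h J) → inverseBinomial g I ≡ inverseBinomial h I
inverseBinomial-cong I g≗h = sumTo-cong (suc I) (λ J → cong (binInv I J *_) (g≗h J))

inverseBinomial-+ : ∀ g h I →
                    inverseBinomial (λ J → g J + h J) I ≡ inverseBinomial g I + inverseBinomial h I
inverseBinomial-+ g h I =
  trans (sumTo-cong (suc I) (λ J → ℤ.*-distribˡ-+ (binInv I J) (g J) (h J))) (sumTo-+ (suc I) _ _)

inverseBinomial-suc : ∀ g I →
                      inverseBinomial g (suc I) ≡ inverseBinomial (g ∘ suc) I - inverseBinomial g I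
inverseBinomial-suc g I = begin
  inverseBinomial g (suc I)
    ≡⟨ sumTo-suc (suc I) _ ⟩
  binInv (suc I) 0 * g 0 + sumTo (suc I) (λ J → binInv (suc I) (suc J) * g (suc J))
    ≡⟨ cong₂ _+_ (cong (_* g 0) (binInv-suc-zero I))
                 (sumTo-cong (suc I) λ J → trans (cong (_* g (suc J)) (binInv-suc-suc I J))
                                                 (distribʳ-- (binInv I J) (binInv I (suc J)) (g (suc J)))) ⟩
  - binInv I 0 * g 0 + sumTo (suc I) (λ J → binInv I J * g (suc J) - h J)
    ≡⟨ cong (_+_ (- binInv I 0 * g 0)) (sumTo-- (suc I) _ h) ⟩
  - binInv I 0 * g 0 + (inverseBinomial (g ∘ suc) I - sumTo (suc I) h)
    ≡⟨ cong (λ s → - binInv I 0 * g 0 + (inverseBinomial (g ∘ suc) I - s)) (sumTo-extend I hI≡0) ⟩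
  - binInv I 0 * g 0 + (inverseBinomial (g ∘ suc) I - sumTo I h)
    ≡⟨ rearrange (binInv I 0) (g 0) (inverseBinomial (g ∘ suc) I) (sumTo I h) ⟩
  inverseBinomial (g ∘ suc) I - (binInv I 0 * g 0 + sumTo I h)
    ≡⟨ cong (_-_ (inverseBinomial (g ∘ suc) I)) (sumTo-suc I _) ⟨
  inverseBinomial (g ∘ suc) I - inverseBinomial g I ∎
  where
  open ≡-Reasoning
  h : ℕ → ℤ
  h J = binInv I (suc J) * g (suc J)
  hI≡0 : h I ≡ + 0
  hI≡0 = trans (cong (λ c → (- + 1) ^ (I ℕ.∸ suc I) * + c * g (suc I)) (nC[1+n]≡0 I))
               (trans (cong (_* g (suc I)) (ℤ.*-zeroʳ ((- + 1) ^ (I ℕ.∸ suc I)))) (ℤ.*-zeroˡ (g (suc I))))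
  distribʳ-- : ∀ a b x → (a - b) * x ≡ a * x - b * x
  distribʳ-- = solve-∀
  rearrange : ∀ b x v w → - b * x + (v - w) ≡ v - (b * x + w)
  rearrange = solve-∀

inverseBinomial-binomial : ∀ f I → inverseBinomial (binomial f) I ≡ f I
inverseBinomial-binomial f zero = normalise (f 0)
  where
  normalise : ∀ x → + 0 + + 1 * (+ 0 + + 1 * x) ≡ x
  normalise = solve-∀
inverseBinomial-binomial f (suc I) = begin
  inverseBinomial (binomial f) (suc I)
    ≡⟨ inverseBinomial-suc (binomial f) I ⟩
  inverseBinomial (binomial f ∘ suc) I - inverseBinomial (binomial f) I
    ≡⟨ cong (_- inverseBinomial (binomial f) I)
            (trans (inverseBinomial-cong I (binomial-suc f)) (inverseBinomial-+ (binomial f) _ I)) ⟩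
  (inverseBinomial (binomial f) I + inverseBinomial (binomial (f ∘ suc)) I)
    - inverseBinomial (binomial f) I
    ≡⟨ cancel (inverseBinomial (binomial f) I) (inverseBinomial (binomial (f ∘ suc)) I) ⟩
  inverseBinomial (binomial (f ∘ suc)) I
    ≡⟨ inverseBinomial-binomial (f ∘ suc) I ⟩
  f (suc I) ∎
  where
  open ≡-Reasoning
  cancel : ∀ a b → (a + b) - a ≡ b
  cancel = solve-∀

-- The colimit X ▷̃ Z of a cylinder functor Z

module CylinderFunctor (P : ∀ {N k} → Cyl N k → Set) (P? : ∀ {N k} (z : Cyl N k) → Dec (P z))
                       (invariant : Invariant P) where

  open Cylinders P P?

  Holds : Cyl N k → Set
  Holds z = True (P? z)

  holds-mapCyl : (φ : m ⊑ n) (z : Cyl m k) → Holds (mapCyl φ z) ⇔ Holds z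
  holds-mapCyl φ z = mk⇔ (fromWitness ∘ to ∘ toWitness) (fromWitness ∘ from ∘ toWitness)
    where open Equivalence (invariant φ z)

  ZSimp-≡ : {u v : ZSimp N k} → proj₁ u ≡ proj₁ v → u ≡ v
  ZSimp-≡ {u = z , h} {v = .z , h′} refl = cong (z ,_) (T-irrelevant h h′)

  Reduced : ℕ → ℕ → Set
  Reduced R k = Σ (Cyl R k) λ z → Spanning z × Holds z

  Decomposed : ℕ → ℕ → Set
  Decomposed N k = Σ ℕ λ R → R ⊑ N × Reduced R k

  forget : Decomposed N k → Factored N k
  forget (R , ρ , z , c , _) = R , ρ , z , c

  forget-injective : {w w′ : Decomposed N k} → forget w ≡ forget w′ → w ≡ w′
  forget-injective {w = R , ρ , z , c , h} {w′ = .R , .ρ , .z , .c , h′} refl =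
    cong (λ h → R , ρ , z , c , h) (T-irrelevant h h′)

  mapDecomposed : m ⊑ n → Decomposed m k → Decomposed n k
  mapDecomposed φ (R , ρ , r) = R , φ ∘⊑ ρ , r

  compose : Decomposed N k → ZSimp N k
  compose (R , ρ , z , c , h) = mapCyl ρ z , Equivalence.from (holds-mapCyl ρ z) h

  decompose : (f : Factored N k) → Holds (unfactor f) → Decomposed N k
  decompose (R , ρ , z , c) h = R , ρ , z , c , Equivalence.to (holds-mapCyl ρ z) h

  reduce : ZSimp N k → Decomposed N k
  reduce (z , h) = decompose (factor z) (subst Holds (sym (unfactor-factor z)) h)

  compose-reduce : (u : ZSimp N k) → compose (reduce u) ≡ u
  compose-reduce (z , h) = ZSimp-≡ (unfactor-factor z)

  reduce-compose : (w : Decomposed N k) → reduce (compose w) ≡ w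
  reduce-compose w = forget-injective (factor-unfactor (forget w))

  ZSimp↔Decomposed : ZSimp N k ↔ Decomposed N k
  ZSimp↔Decomposed = mk↔ₛ′ reduce compose reduce-compose compose-reduce

  reduce-mapCyl : (φ : m ⊑ n) (z : Cyl m k) (h : Holds z) (h′ : Holds (mapCyl φ z)) →
                  reduce (mapCyl φ z , h′) ≡ mapDecomposed φ (reduce (z , h))
  reduce-mapCyl φ z h h′ = forget-injective (factor-mapCyl φ z)

  reduce-spanning : (z : Cyl R k) (c : Spanning z) (h : Holds z) →
                    reduce (z , h) ≡ (R , ⊑-id , z , c , h)
  reduce-spanning z c h = forget-injective (factor-spanning z c)

  Reduced-empty : k ℕ.< R → ¬ Reduced R k
  Reduced-empty {k} k<R (cyl a b a+b≡k σ τ , c , _) =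
    ℕ.<⇒≱ k<R (ℕ.≤-trans (covering⇒≤ c) (ℕ.≤-reflexive a+b≡k))

  Decomposed-empty : N ℕ.< R → ¬ (R ⊑ N × Reduced R k)
  Decomposed-empty N<R (ρ , _) = ℕ.<⇒≱ N<R (⊑⇒≤ ρ)

  module Normalisation (X : AugSemiSimplicialSet) (k : ℕ) where

    NormalForm : Set
    NormalForm = Σ ℕ λ R → Simp X R × Reduced R k

    normalise : Simp X N → Decomposed N k → NormalForm
    normalise x (R , ρ , r) = R , act X ρ x , r

    nf : Elt X k → NormalForm
    nf (elt N x z h) = normalise x (reduce (z , h))

    embed : NormalForm → Elt X k
    embed (R , y , z , _ , h) = elt R y z h

    normalise-mapDecomposed : (φ : m ⊑ n) (x : Simp X n) (w : Decomposed m k) →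
                              normalise x (mapDecomposed φ w) ≡ normalise (act X φ x) w
    normalise-mapDecomposed φ x (R , ρ , r) = cong (λ y → R , y , r) (act-∘ X φ ρ x)

    nf-gen : ∀ {e e′} → Gen X k e e′ → nf e ≡ nf e′
    nf-gen (gen φ x z h h′) = begin
      normalise (act X φ x) (reduce (z , h))        ≡⟨ normalise-mapDecomposed φ x (reduce (z , h)) ⟨
      normalise x (mapDecomposed φ (reduce (z , h))) ≡⟨ cong (normalise x) (reduce-mapCyl φ z h h′) ⟨
      normalise x (reduce (mapCyl φ z , h′))        ∎
      where open ≡-Reasoning

    nf-cong : ∀ {e e′} → EqClosure (Gen X k) e e′ → nf e ≡ nf e′
    nf-cong = EqClosure.gfold isEquivalence nf nf-gen

    nf-embed : (u : NormalForm) → nf (embed u) ≡ u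
    nf-embed (R , y , z , c , h) =
      trans (cong (normalise y) (reduce-spanning z c h)) (cong (λ y → R , y , z , c , h) (act-id X y))

    embed-normalise : (x : Simp X N) (w : Decomposed N k) →
                      Gen X k (embed (normalise x w)) (Product.uncurry (elt N x) (compose w))
    embed-normalise x (R , ρ , z , c , h) = gen ρ x z h _

    embed-nf : (e : Elt X k) → EqClosure (Gen X k) (embed (nf e)) e
    embed-nf (elt N x z h) =
      subst (EqClosure (Gen X k) (embed (nf (elt N x z h))) ∘ Product.uncurry (elt N x))
            (compose-reduce (z , h))
            (EqClosure.return (embed-normalise x (reduce (z , h))))

    colimit-hasCard : NormalForm ↔ Fin n → HasCard (ColimSetoid X k) n
    colimit-hasCard = hasCard-normalForms (ColimSetoid X k) nf nf-cong embed nf-embed embed-nf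

  module Counting (B : ℕ → ℕ → ℕ) (hB : ∀ N k → ZSimp N k ↔ Fin (B N k)) (k : ℕ) where

    reduced-finite : ∀ R → Σ ℕ λ s → Reduced R k ↔ Fin s
    reduced-finite R =
      Product.map₂ (↔-trans Reduced↔)
                   (finite-subset (hB R k) (spanning? ∘ proj₁) (λ {(z , _)} → Spanning-irrelevant z))
      where
      Reduced↔ : Reduced R k ↔ Σ (ZSimp R k) (Spanning ∘ proj₁)
      Reduced↔ = mk↔ₛ′ (λ (z , c , h) → (z , h) , c) (λ ((z , h) , c) → z , c , h)
                       (λ _ → refl) (λ _ → refl)

    S : ℕ → ℕ
    S R = proj₁ (reduced-finite R)

    S-vanishes : k ℕ.< R → S R ≡ 0
    S-vanishes {R} k<R = card-unique (proj₂ (reduced-finite R)) (↔Fin0 (Reduced-empty k<R))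

    B-binomial : ∀ N → B N k ≡ natSum (suc N) (λ R → (N C R) ℕ.* S R)
    B-binomial N = card-unique (hB N k) (↔-trans ZSimp↔Decomposed
      (Σ-ℕ↔natSum (suc N) (λ _ → Decomposed-empty)
                          (λ R → ↔-trans (thinnings↔ R N ×-↔ proj₂ (reduced-finite R)) *↔)))

    binInvMul-B : ∀ I → binInvMul (λ I K → + B I K) I k ≡ + S I
    binInvMul-B I = trans (inverseBinomial-cong I B≡binomial) (inverseBinomial-binomial (+_ ∘ S) I)
      where
      B≡binomial : ∀ J → + B J k ≡ binomial (+_ ∘ S) J
      B≡binomial J = begin
        + B J k                                    ≡⟨ cong +_ (B-binomial J) ⟩
        + natSum (suc J) (λ R → (J C R) ℕ.* S R)   ≡⟨ pos-natSum (suc J) _ ⟩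
        sumTo (suc J) (λ R → + ((J C R) ℕ.* S R))  ≡⟨ sumTo-cong (suc J) (λ R → ℤ.pos-* (J C R) (S R)) ⟩
        binomial (+_ ∘ S) J                        ∎
        where open ≡-Reasoning

    normalForms↔ : (X : AugSemiSimplicialSet) (sz : ℕ → ℕ) → (∀ R → Simp X R ↔ Fin (sz R)) →
                   Normalisation.NormalForm X k ↔ Fin (natSum (suc k) (λ R → sz R ℕ.* S R))
    normalForms↔ X sz hX = Σ-ℕ↔natSum (suc k) (λ R k<R → Reduced-empty k<R ∘ proj₂)
                                               (λ R → ↔-trans (hX R ×-↔ proj₂ (reduced-finite R)) *↔)

  countFormula : CountFormula P P?
  countFormula X sz hX B hB k =
    c , Normalisation.colimit-hasCard X k (normalForms↔ X sz hX) ,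
    suc k , (λ I k<I → trans (binInvMul-B I) (cong +_ (S-vanishes k<I))) , value
    where
    open Counting B hB k
    c : ℕ
    c = natSum (suc k) (λ R → sz R ℕ.* S R)
    value : + c ≡ sumTo (suc k) (λ I → + sz I * binInvMul (λ I K → + B I K) I k)
    value = trans (pos-natSum (suc k) _) (sumTo-cong (suc k) λ I →
      trans (ℤ.pos-* (sz I) (S I)) (cong (_*_ (+ sz I)) (sym (binInvMul-B I))))

mainTheorem2 : CountFormula Weak Weak? × CountFormula Strict Strict? × CountFormula NoCond NoCond?
mainTheorem2 = CylinderFunctor.countFormula Weak Weak? weak-invariant
             , CylinderFunctor.countFormula Strict Strict? strict-invariant
             , CylinderFunctor.countFormula NoCond NoCond? noCond-invariant
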